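{- Let $X, Y \subseteq \omega$. If there is an embedding $\mathcal{K}_2^X \hookrightarrow \mathcal{K}_1^Y$, then $X' \le_T Y$.
   Context: $X'$ is the Turing jump of $X$. An embedding of pcas is an injective map $f$ such that whenever $ab$ is defined, $f(a)f(b)$ is defined and equals $f(ab)$. $\mathcal{K}_1^Y$ is the pca on $\omega$ with $n \cdot m = \Phi^Y_n(m)$. $\mathcal{K}_2^X$ is the pca of total $X$-computable functions $\omega \to \omega$ with $g \cdot h = \Phi^{g \oplus h}_{g(0)}$, defined iff this is total ($\Phi_e$ the $e$-th Turing functional, $(g\oplus h)(2n)=g(n)$, $(g\oplus h)(2n+1)=h(n)$). -}

module Defs where

open import Data.Nat using (ℕ; zero; suc; _+_)
open import Data.Bool using (Bool; true; false)
open import Data.Maybe using (Maybe; just; nothing; _>>=_)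
open import Data.Product using (Σ; ∃; _×_; _,_; proj₁; proj₂)
open import Relation.Binary.PropositionalEquality using (_≡_)
open import Relation.Nullary using (¬_)

-- Cantor pairing (a bijection ℕ × ℕ ≅ ℕ)
-- enumeration order (0,0),(1,0),(0,1),(2,0),(1,1),(0,2),…

tri : ℕ → ℕ
tri zero    = zero
tri (suc s) = suc s + tri s

pair : ℕ → ℕ → ℕ
pair x y = tri (x + y) + y

nextPair : ℕ × ℕ → ℕ × ℕ
nextPair (zero  , y) = (suc y , zero)
nextPair (suc x , y) = (x , suc y)

unpair : ℕ → ℕ × ℕ
unpair zero    = (zero , zero)
unpair (suc n) = nextPair (unpair n)

-- Oracle computation: a standard Gödel numbering of the unary partial
-- recursive functions relative to an oracle O : ℕ → ℕ.
-- An index e is decoded as e = pair t r, r = pair a b, with instruction t: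
--   0 : x ↦ 0
--   1 : x ↦ x + 1
--   2 : x ↦ first component of unpair x
--   3 : x ↦ second component of unpair x
--   4 : x ↦ O x                         (oracle query)
--   5 : x ↦ Φ_a (Φ_b x)                 (composition)
--   6 : x ↦ pair (Φ_a x) (Φ_b x)        (pairing)
--   7 : pair x n ↦ R x n, where R x 0 = Φ_a x,
--                  R x (n+1) = Φ_b (pair x (pair n (R x n)))   (prim. recursion)
--   8 : x ↦ least n with Φ_a (pair x n) = 0, all earlier values defined (μ)
--   ≥9: x ↦ x
-- Evaluation is step-indexed by a fuel parameter.

Oracle : Set
Oracle = ℕ → ℕ

recLoop : (ℕ → ℕ → Maybe ℕ) → ℕ → ℕ → ℕ → ℕ → Maybe ℕ
recLoop ev a b x zero    = ev a x
recLoop ev a b x (suc n) =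
  recLoop ev a b x n >>= λ r → ev b (pair x (pair n r))

muLoop : (ℕ → ℕ → Maybe ℕ) → ℕ → ℕ → ℕ → ℕ → Maybe ℕ
muLoop ev a x i zero        = nothing
muLoop ev a x i (suc bound) =
  ev a (pair x i) >>= λ { zero → just i ; (suc _) → muLoop ev a x (suc i) bound }

step : ℕ → (ℕ → ℕ → Maybe ℕ) → Oracle → ℕ → ℕ → ℕ → ℕ → Maybe ℕ
step zero ev O k a b x = just zero
step (suc zero) ev O k a b x = just (suc x)
step (suc (suc zero)) ev O k a b x = just (proj₁ (unpair x))
step (suc (suc (suc zero))) ev O k a b x = just (proj₂ (unpair x))
step (suc (suc (suc (suc zero)))) ev O k a b x = just (O x)
step (suc (suc (suc (suc (suc zero))))) ev O k a b x = ev b x >>= ev a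
step (suc (suc (suc (suc (suc (suc zero)))))) ev O k a b x =
  ev a x >>= λ u → ev b x >>= λ v → just (pair u v)
step (suc (suc (suc (suc (suc (suc (suc zero))))))) ev O k a b x =
  recLoop ev a b (proj₁ (unpair x)) (proj₂ (unpair x))
step (suc (suc (suc (suc (suc (suc (suc (suc zero)))))))) ev O k a b x =
  muLoop ev a x zero k
step (suc (suc (suc (suc (suc (suc (suc (suc (suc _))))))))) ev O k a b x = just x

eval : ℕ → Oracle → ℕ → ℕ → Maybe ℕ
eval zero    O e x = nothing
eval (suc k) O e x =
  step (proj₁ (unpair e)) (eval k O) O k
       (proj₁ (unpair (proj₂ (unpair e))))
       (proj₂ (unpair (proj₂ (unpair e)))) x

_⊢Φ_⟨_⟩↓_ : Oracle → ℕ → ℕ → ℕ → Set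
O ⊢Φ e ⟨ x ⟩↓ y = ∃ λ k → eval k O e x ≡ just y

_⊢Φ_⟨_⟩↓ : Oracle → ℕ → ℕ → Set
O ⊢Φ e ⟨ x ⟩↓ = ∃ λ y → O ⊢Φ e ⟨ x ⟩↓ y

Subset : Set
Subset = ℕ → Bool

χ : Subset → Oracle
χ X n with X n
... | true  = 1
... | false = 0

Jump : Subset → ℕ → Set
Jump X e = χ X ⊢Φ e ⟨ e ⟩↓

_≤T_ : (ℕ → Set) → Subset → Set
P ≤T Y = ∃ λ e → ∀ n → (P n → χ Y ⊢Φ e ⟨ n ⟩↓ 1) × (¬ P n → χ Y ⊢Φ e ⟨ n ⟩↓ 0)

-- The pca 𝒦₁^Y : carrier ℕ, n · m = Φ^Y_n(m)

-- The pca 𝒦₂^X : carrier the total X-computable functions ℕ → ℕ,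
-- g · h = Φ^{g ⊕ h}_{g(0)}, defined iff total.

_⊕_ : Oracle → Oracle → Oracle
(g ⊕ h) zero             = g zero
(g ⊕ h) (suc zero)       = h zero
(g ⊕ h) (suc (suc n))    = ((λ m → g (suc m)) ⊕ (λ m → h (suc m))) n

IsComputableIn : Subset → (ℕ → ℕ) → Set
IsComputableIn X g = ∃ λ e → ∀ n → χ X ⊢Φ e ⟨ n ⟩↓ g n

K₂ : Subset → Set
K₂ X = Σ (ℕ → ℕ) (IsComputableIn X)

_≈₂_ : {X : Subset} → K₂ X → K₂ X → Set
g ≈₂ h = ∀ n → proj₁ g n ≡ proj₁ h n

App₂ : {X : Subset} → K₂ X → K₂ X → K₂ X → Set
App₂ g h k = ∀ n → (proj₁ g ⊕ proj₁ h) ⊢Φ (proj₁ g 0) ⟨ n ⟩↓ (proj₁ k n)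

record Embedding (X Y : Subset) : Set where
  field
    f         : K₂ X → ℕ
    f-wd      : ∀ g h → g ≈₂ h → f g ≡ f h
    f-inj     : ∀ g h → f g ≡ f h → g ≈₂ h
    f-app     : ∀ g h k → App₂ g h k → χ Y ⊢Φ (f g) ⟨ f h ⟩↓ (f k)

{-# OPTIONS --safe #-}
-- Let f be the embedding and const n the constant function n. An element succ of 𝒦₂^X has
-- succ · const n = const (n + 1), so n ↦ f (const n) is Y-computable by primitive recursion
-- from f (const 0) and f succ. An element halting has halting · const n = halts n, where
-- halts n ⟨k , m⟩ = 1 iff a small-step machine evaluating Φ^X_n(n) with fuel k is done after
-- m steps; halts n is total and X-computable since a machine step is primitive recursive in X.
-- So halts n = const 0 iff n ∉ X′, and as f is injective, n ∈ X′ iff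
-- Φ^Y_{f halting}(f (const n)) ≠ f (const 0), which Y decides.
module Submission where

open import Defs
open import Data.Nat using (ℕ; zero; suc; _+_; _∸_; pred; _≤_; _≤′_; ≤′-refl; ≤′-step; _⊔_)
open import Data.Nat.Properties
open import Data.List using (List; []; _∷_)
open import Data.Maybe using (Maybe; just; nothing; _>>=_)
open import Data.Product using (∃; _,_; proj₁; proj₂)
open import Data.Sum using (inj₁; inj₂)
open import Data.Empty using (⊥-elim)
open import Relation.Nullary using (¬_)
open import Relation.Binary.PropositionalEquality
open import Function using (_∘_)

unpair-tri : ∀ s → unpair (tri s) ≡ (s , 0)
unpair-tri+ : ∀ s x y → x + y ≡ s → unpair (tri s + y) ≡ (x , y)
unpair-tri zero = refl
unpair-tri (suc s) rewrite +-comm s (tri s) | unpair-tri+ s 0 s refl = refl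
unpair-tri+ s x zero refl rewrite +-identityʳ x | +-identityʳ (tri x) = unpair-tri x
unpair-tri+ s x (suc y) x+1+y≡s rewrite +-suc (tri s) y
  | unpair-tri+ s (suc x) y (trans (sym (+-suc x y)) x+1+y≡s) = refl

unpair-pair : ∀ x y → unpair (pair x y) ≡ (x , y)
unpair-pair x y = unpair-tri+ (x + y) x y refl

-- Fuel monotonicity of eval

Evaluator : Set
Evaluator = ℕ → ℕ → Maybe ℕ

_⊑_ : Evaluator → Evaluator → Set
ev ⊑ ev′ = ∀ e x y → ev e x ≡ just y → ev′ e x ≡ just y

recLoop-mono : ∀ {ev ev′} → ev ⊑ ev′ →
               ∀ a b x n y → recLoop ev a b x n ≡ just y → recLoop ev′ a b x n ≡ just y
recLoop-mono ev⊑ev′ a b x zero y eq = ev⊑ev′ a x y eq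
recLoop-mono {ev} ev⊑ev′ a b x (suc n) y eq with recLoop ev a b x n in rec≡
... | just r rewrite recLoop-mono ev⊑ev′ a b x n r rec≡ = ev⊑ev′ b _ y eq

muLoop-mono : ∀ {ev ev′} → ev ⊑ ev′ →
              ∀ a x i k y → muLoop ev a x i k ≡ just y → muLoop ev′ a x i (suc k) ≡ just y
muLoop-mono {ev} ev⊑ev′ a x i (suc k) y eq with ev a (pair x i) in test≡
... | just zero    rewrite ev⊑ev′ a (pair x i) zero test≡ = eq
... | just (suc r) rewrite ev⊑ev′ a (pair x i) (suc r) test≡ = muLoop-mono ev⊑ev′ a x (suc i) k y eq

step-mono : ∀ {ev ev′} O → ev ⊑ ev′ →
            ∀ t k a b x y → step t ev O k a b x ≡ just y → step t ev′ O (suc k) a b x ≡ just y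
step-mono O ev⊑ev′ 0 k a b x y eq = eq
step-mono O ev⊑ev′ 1 k a b x y eq = eq
step-mono O ev⊑ev′ 2 k a b x y eq = eq
step-mono O ev⊑ev′ 3 k a b x y eq = eq
step-mono O ev⊑ev′ 4 k a b x y eq = eq
step-mono {ev} O ev⊑ev′ 5 k a b x y eq with ev b x in inner≡
... | just r rewrite ev⊑ev′ b x r inner≡ = ev⊑ev′ a r y eq
step-mono {ev} O ev⊑ev′ 6 k a b x y eq with ev a x in fst≡ | ev b x in snd≡
... | just u | just v rewrite ev⊑ev′ a x u fst≡ | ev⊑ev′ b x v snd≡ = eq
step-mono O ev⊑ev′ 7 k a b x y eq =
  recLoop-mono ev⊑ev′ a b (proj₁ (unpair x)) (proj₂ (unpair x)) y eq
step-mono O ev⊑ev′ 8 k a b x y eq = muLoop-mono ev⊑ev′ a x zero k y eq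
step-mono O ev⊑ev′ (suc (suc (suc (suc (suc (suc (suc (suc (suc _))))))))) k a b x y eq = eq

eval-suc-mono : ∀ k O → eval k O ⊑ eval (suc k) O
eval-suc-mono (suc k) O e x y = step-mono O (eval-suc-mono k O) (proj₁ (unpair e)) k _ _ x y

eval-mono : ∀ {k k′} O → k ≤ k′ → eval k O ⊑ eval k′ O
eval-mono {k} O k≤k′ e x y eq = go (≤⇒≤′ k≤k′)
  where
  go : ∀ {k′} → k ≤′ k′ → eval k′ O e x ≡ just y
  go ≤′-refl         = eq
  go (≤′-step k≤′k′) = eval-suc-mono _ O e x y (go k≤′k′)

eval-⊔ˡ : ∀ k k′ O → eval k O ⊑ eval (k ⊔ k′) O
eval-⊔ˡ k k′ O = eval-mono O (m≤m⊔n k k′)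

eval-⊔ʳ : ∀ k k′ O → eval k′ O ⊑ eval (k ⊔ k′) O
eval-⊔ʳ k k′ O = eval-mono O (m≤n⊔m k k′)

instr : ℕ → ℕ → ℕ → ℕ
instr t a b = pair t (pair a b)

eval-instr : ∀ k O t a b x → eval (suc k) O (instr t a b) x ≡ step t (eval k O) O k a b x
eval-instr k O t a b x rewrite unpair-pair t (pair a b) | unpair-pair a b = refl

compose pairing primrec : ℕ → ℕ → ℕ
compose = instr 5
pairing = instr 6
primrec = instr 7

⊢compose : ∀ {O a b x y z} → O ⊢Φ b ⟨ x ⟩↓ y → O ⊢Φ a ⟨ y ⟩↓ z → O ⊢Φ compose a b ⟨ x ⟩↓ z
⊢compose {O} {a} {b} {x} {y} {z} (k , b↓) (k′ , a↓) = suc (k ⊔ k′) , (begin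
  eval (suc (k ⊔ k′)) O (compose a b) x                ≡⟨ eval-instr (k ⊔ k′) O 5 a b x ⟩
  (eval (k ⊔ k′) O b x >>= eval (k ⊔ k′) O a)          ≡⟨ cong (_>>= eval (k ⊔ k′) O a) (eval-⊔ˡ k k′ O b x y b↓) ⟩
  eval (k ⊔ k′) O a y                                  ≡⟨ eval-⊔ʳ k k′ O a y z a↓ ⟩
  just z                                               ∎)
  where open ≡-Reasoning

⊢pairing : ∀ {O a b x u v} → O ⊢Φ a ⟨ x ⟩↓ u → O ⊢Φ b ⟨ x ⟩↓ v → O ⊢Φ pairing a b ⟨ x ⟩↓ pair u v
⊢pairing {O} {a} {b} {x} (k , a↓) (k′ , b↓) = suc (k ⊔ k′) ,
  trans (eval-instr (k ⊔ k′) O 6 a b x)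
        (cong₂ (λ p q → p >>= λ u → q >>= λ v → just (pair u v))
               (eval-⊔ˡ k k′ O a x _ a↓) (eval-⊔ʳ k k′ O b x _ b↓))

⊢primrec : ∀ {O a b} z (r : ℕ → ℕ) →
           O ⊢Φ a ⟨ proj₁ (unpair z) ⟩↓ r 0 →
           (∀ i → O ⊢Φ b ⟨ pair (proj₁ (unpair z)) (pair i (r i)) ⟩↓ r (suc i)) →
           O ⊢Φ primrec a b ⟨ z ⟩↓ r (proj₂ (unpair z))
⊢primrec {O} {a} {b} z r base↓ step↓ = suc (proj₁ (loop n)) ,
  trans (eval-instr (proj₁ (loop n)) O 7 a b z) (proj₂ (loop n))
  where
  x = proj₁ (unpair z)
  n = proj₂ (unpair z)
  loop : ∀ n → ∃ λ k → recLoop (eval k O) a b x n ≡ just (r n)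
  loop zero = base↓
  loop (suc n) with loop n | step↓ n
  ... | k , rec↓ | k′ , b↓ = k ⊔ k′ ,
    trans (cong (_>>= λ s → eval (k ⊔ k′) O b (pair x (pair n s)))
                (recLoop-mono (eval-⊔ˡ k k′ O) a b x n (r n) rec↓))
          (eval-⊔ʳ k k′ O b _ _ b↓)

-- Primitive recursive programs on binary trees

data Tree : Set where
  leaf : ℕ → Tree
  node : Tree → Tree → Tree

encode : Tree → ℕ
encode (leaf n)   = n
encode (node u v) = pair (encode u) (encode v)

-- On a leaf the projections unpair its code, so a program only sees the code of its input.
left right : Tree → Tree
left (leaf n)    = leaf (proj₁ (unpair n))
left (node u v)  = u
right (leaf n)   = leaf (proj₂ (unpair n))
right (node u v) = v

encode-left : ∀ v → encode (left v) ≡ proj₁ (unpair (encode v))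
encode-left (leaf n)   = refl
encode-left (node u v) = cong proj₁ (sym (unpair-pair (encode u) (encode v)))

encode-right : ∀ v → encode (right v) ≡ proj₂ (unpair (encode v))
encode-right (leaf n)   = refl
encode-right (node u v) = cong proj₂ (sym (unpair-pair (encode u) (encode v)))

infixr 9 _∙_
data Prog : Set where
  Z S π₁ π₂ ask I : Prog
  _∙_ ⟨_,_⟩ R : Prog → Prog → Prog

⟦_⟧ : Prog → Oracle → Tree → Tree
⟦R_,_⟧ : Prog → Prog → Oracle → Tree → ℕ → Tree
⟦ Z ⟧ O v       = leaf 0
⟦ S ⟧ O v       = leaf (suc (encode v))
⟦ π₁ ⟧ O v      = left v
⟦ π₂ ⟧ O v      = right v
⟦ ask ⟧ O v     = leaf (O (encode v))
⟦ I ⟧ O v       = v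
⟦ p ∙ q ⟧ O v   = ⟦ p ⟧ O (⟦ q ⟧ O v)
⟦ ⟨ p , q ⟩ ⟧ O v = node (⟦ p ⟧ O v) (⟦ q ⟧ O v)
⟦ R p q ⟧ O v   = ⟦R p , q ⟧ O (left v) (encode (right v))
⟦R p , q ⟧ O x zero    = ⟦ p ⟧ O x
⟦R p , q ⟧ O x (suc n) = ⟦ q ⟧ O (node x (node (leaf n) (⟦R p , q ⟧ O x n)))

compile : Prog → ℕ
compile Z           = pair 0 0
compile S           = pair 1 0
compile π₁          = pair 2 0
compile π₂          = pair 3 0
compile ask         = pair 4 0
compile I           = pair 9 0
compile (p ∙ q)     = compose (compile p) (compile q)
compile ⟨ p , q ⟩   = pairing (compile p) (compile q)
compile (R p q)     = primrec (compile p) (compile q)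

-- Sealed so that type checking never normalises the (huge) Gödel numbers.
opaque
  code : Prog → ℕ
  code = compile

  code≡compile : ∀ p → code p ≡ compile p
  code≡compile p = refl

code-∙ : ∀ p q → code (p ∙ q) ≡ compose (code p) (code q)
code-∙ p q = trans (code≡compile (p ∙ q)) (sym (cong₂ compose (code≡compile p) (code≡compile q)))

code-⟨,⟩ : ∀ p q → code ⟨ p , q ⟩ ≡ pairing (code p) (code q)
code-⟨,⟩ p q = trans (code≡compile ⟨ p , q ⟩) (sym (cong₂ pairing (code≡compile p) (code≡compile q)))

code-R : ∀ p q → code (R p q) ≡ primrec (code p) (code q)
code-R p q = trans (code≡compile (R p q)) (sym (cong₂ primrec (code≡compile p) (code≡compile q)))

⊢atomic : ∀ O p t x y → code p ≡ pair t 0 → step t (eval 0 O) O 0 0 0 x ≡ just y → O ⊢Φ code p ⟨ x ⟩↓ y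
⊢atomic O p t x y code≡ step≡ = 1 , trans (cong (λ e → eval 1 O e x) code≡) (trans (eval-instr 0 O t 0 0 x) step≡)

code-correct : ∀ O p v → O ⊢Φ code p ⟨ encode v ⟩↓ encode (⟦ p ⟧ O v)
code-correct O Z v   = ⊢atomic O Z 0 _ _ (code≡compile Z) refl
code-correct O S v   = ⊢atomic O S 1 _ _ (code≡compile S) refl
code-correct O π₁ v  = ⊢atomic O π₁ 2 _ _ (code≡compile π₁) (cong just (sym (encode-left v)))
code-correct O π₂ v  = ⊢atomic O π₂ 3 _ _ (code≡compile π₂) (cong just (sym (encode-right v)))
code-correct O ask v = ⊢atomic O ask 4 _ _ (code≡compile ask) refl
code-correct O I v   = ⊢atomic O I 9 _ _ (code≡compile I) refl
code-correct O (p ∙ q) v = subst (λ e → O ⊢Φ e ⟨ encode v ⟩↓ encode (⟦ p ∙ q ⟧ O v)) (sym (code-∙ p q))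
  (⊢compose (code-correct O q v) (code-correct O p (⟦ q ⟧ O v)))
code-correct O ⟨ p , q ⟩ v = subst (λ e → O ⊢Φ e ⟨ encode v ⟩↓ encode (⟦ ⟨ p , q ⟩ ⟧ O v)) (sym (code-⟨,⟩ p q))
  (⊢pairing (code-correct O p v) (code-correct O q v))
code-correct O (R p q) v = subst₂ (λ e n → O ⊢Φ e ⟨ encode v ⟩↓ encode (⟦R p , q ⟧ O (left v) n))
  (sym (code-R p q)) (sym (encode-right v))
  (⊢primrec (encode v) (λ i → encode (⟦R p , q ⟧ O (left v) i))
    (subst (λ m → O ⊢Φ code p ⟨ m ⟩↓ encode (⟦ p ⟧ O (left v))) (encode-left v) (code-correct O p (left v)))
    (λ i → subst (λ m → O ⊢Φ code q ⟨ pair m (pair i (encode (⟦R p , q ⟧ O (left v) i))) ⟩↓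
                          encode (⟦R p , q ⟧ O (left v) (suc i))) (encode-left v)
             (code-correct O q (node (left v) (node (leaf i) (⟦R p , q ⟧ O (left v) i))))))

⟦⟧-leaf : ∀ O p v → encode (⟦ p ⟧ O v) ≡ encode (⟦ p ⟧ O (leaf (encode v)))
⟦⟧-cong : ∀ O p {v w} → encode v ≡ encode w → encode (⟦ p ⟧ O v) ≡ encode (⟦ p ⟧ O w)
⟦R⟧-cong : ∀ O p q {x y} n → encode x ≡ encode y → encode (⟦R p , q ⟧ O x n) ≡ encode (⟦R p , q ⟧ O y n)
⟦⟧-leaf O Z v   = refl
⟦⟧-leaf O S v   = refl
⟦⟧-leaf O π₁ v  = encode-left v
⟦⟧-leaf O π₂ v  = encode-right v
⟦⟧-leaf O ask v = refl
⟦⟧-leaf O I v   = refl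
⟦⟧-leaf O (p ∙ q) v = ⟦⟧-cong O p (⟦⟧-leaf O q v)
⟦⟧-leaf O ⟨ p , q ⟩ v = cong₂ pair (⟦⟧-leaf O p v) (⟦⟧-leaf O q v)
⟦⟧-leaf O (R p q) v = trans (cong (λ n → encode (⟦R p , q ⟧ O (left v) n)) (encode-right v))
  (⟦R⟧-cong O p q (proj₂ (unpair (encode v))) (encode-left v))
⟦⟧-cong O p {v} {w} v≈w = trans (⟦⟧-leaf O p v) (trans (cong (λ m → encode (⟦ p ⟧ O (leaf m))) v≈w) (sym (⟦⟧-leaf O p w)))
⟦R⟧-cong O p q zero x≈y    = ⟦⟧-cong O p x≈y
⟦R⟧-cong O p q (suc n) x≈y = ⟦⟧-cong O q (cong₂ pair x≈y (cong (pair n) (⟦R⟧-cong O p q n x≈y)))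

# : ℕ → Prog
# zero    = Z
# (suc n) = S ∙ # n

#-correct : ∀ O n v → encode (⟦ # n ⟧ O v) ≡ n
#-correct O zero v    = refl
#-correct O (suc n) v = cong suc (#-correct O n v)

-- Every branch is run on the original input v; the default d is run on
-- node v (leaf m), where m is the selector minus the number of branches.
cases : List Prog → Prog → Prog
cases [] d       = d
cases (p ∷ ps) d = R p (cases ps d ∙ ⟨ π₁ , π₁ ∙ π₂ ⟩)

switch : Prog → List Prog → Prog → Prog
switch sel ps d = cases ps d ∙ ⟨ I , sel ⟩

if0 : Prog → Prog → Prog → Prog
if0 sel p d = switch sel (p ∷ []) d

if0-zero : ∀ O sel p d v → encode (⟦ sel ⟧ O v) ≡ 0 →
           encode (⟦ if0 sel p d ⟧ O v) ≡ encode (⟦ p ⟧ O v)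
if0-zero O sel p d v sel≡0 = cong (λ m → encode (⟦R p , d ∙ ⟨ π₁ , π₁ ∙ π₂ ⟩ ⟧ O v m)) sel≡0

if0-suc : ∀ O sel p d v m → encode (⟦ sel ⟧ O v) ≡ suc m →
          encode (⟦ if0 sel p d ⟧ O v) ≡ encode (⟦ d ⟧ O (node v (leaf m)))
if0-suc O sel p d v m sel≡1+m = cong (λ m → encode (⟦R p , d ∙ ⟨ π₁ , π₁ ∙ π₂ ⟩ ⟧ O v m)) sel≡1+m

predᵖ : Prog
predᵖ = R Z (π₁ ∙ π₂) ∙ ⟨ I , I ⟩

predᵖ-correct : ∀ O v → encode (⟦ predᵖ ⟧ O v) ≡ pred (encode v)
predᵖ-correct O v with encode v
... | zero  = refl
... | suc m = refl

monusᵖ : Prog → Prog → Prog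
monusᵖ p q = R I (predᵖ ∙ π₂ ∙ π₂) ∙ ⟨ p , q ⟩

monusᵖ-correct : ∀ O p q v → encode (⟦ monusᵖ p q ⟧ O v) ≡ encode (⟦ p ⟧ O v) ∸ encode (⟦ q ⟧ O v)
monusᵖ-correct O p q v = loop (encode (⟦ q ⟧ O v))
  where
  loop : ∀ m → encode (⟦R I , predᵖ ∙ π₂ ∙ π₂ ⟧ O (⟦ p ⟧ O v) m) ≡ encode (⟦ p ⟧ O v) ∸ m
  loop zero    = refl
  loop (suc m) = trans (predᵖ-correct O (⟦R I , predᵖ ∙ π₂ ∙ π₂ ⟧ O (⟦ p ⟧ O v) m))
                       (trans (cong pred (loop m)) (pred[m∸n]≡m∸[1+n] _ m))

≠ᵖ : ℕ → Prog
≠ᵖ c = if0 (monusᵖ I (# c)) (if0 (monusᵖ (# c) I) Z (# 1)) (# 1)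

module _ (O : Oracle) (c v : ℕ) where
  private
    v∸c : encode (⟦ monusᵖ I (# c) ⟧ O (leaf v)) ≡ v ∸ c
    v∸c = trans (monusᵖ-correct O I (# c) (leaf v)) (cong (v ∸_) (#-correct O c (leaf v)))

    c∸v : encode (⟦ monusᵖ (# c) I ⟧ O (leaf v)) ≡ c ∸ v
    c∸v = trans (monusᵖ-correct O (# c) I (leaf v)) (cong (_∸ v) (#-correct O c (leaf v)))

    inner : Prog
    inner = if0 (monusᵖ (# c) I) Z (# 1)

  ≠ᵖ-≡ : v ≡ c → encode (⟦ ≠ᵖ c ⟧ O (leaf v)) ≡ 0
  ≠ᵖ-≡ refl = trans (if0-zero O (monusᵖ I (# c)) inner (# 1) (leaf c) (trans v∸c (n∸n≡0 c)))
                    (if0-zero O (monusᵖ (# c) I) Z (# 1) (leaf c) (trans c∸v (n∸n≡0 c)))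

  ≠ᵖ-≢ : ¬ v ≡ c → encode (⟦ ≠ᵖ c ⟧ O (leaf v)) ≡ 1
  ≠ᵖ-≢ v≢c with v ∸ c in v∸c≡ | c ∸ v in c∸v≡
  ... | suc m | _     = if0-suc O (monusᵖ I (# c)) inner (# 1) (leaf v) m (trans v∸c v∸c≡)
  ... | zero  | suc m = trans (if0-zero O (monusᵖ I (# c)) inner (# 1) (leaf v) (trans v∸c v∸c≡))
                              (if0-suc O (monusᵖ (# c) I) Z (# 1) (leaf v) m (trans c∸v c∸v≡))
  ... | zero  | zero  = ⊥-elim (v≢c (≤-antisym (m∸n≡0⇒m≤n v∸c≡) (m∸n≡0⇒m≤n c∸v≡)))

twice : ℕ → ℕ
twice zero    = zero
twice (suc m) = suc (suc (twice m))

⊕-twice : ∀ (g h : Oracle) m → (g ⊕ h) (twice m) ≡ g m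
⊕-twice g h zero    = refl
⊕-twice g h (suc m) = ⊕-twice (λ k → g (suc k)) (λ k → h (suc k)) m

twice-sucᵖ : Prog
twice-sucᵖ = R (# 2) (S ∙ S ∙ π₂ ∙ π₂) ∙ ⟨ I , I ⟩

twice-sucᵖ-correct : ∀ O x → encode (⟦ twice-sucᵖ ⟧ O (leaf x)) ≡ twice (suc x)
twice-sucᵖ-correct O x = loop x
  where
  loop : ∀ m → encode (⟦R # 2 , S ∙ S ∙ π₂ ∙ π₂ ⟧ O (leaf x) m) ≡ twice (suc m)
  loop zero    = refl
  loop (suc m) = cong (λ n → suc (suc n)) (loop m)

codeᵖ : Prog → Prog
codeᵖ Z         = ⟨ # 0 , Z ⟩
codeᵖ S         = ⟨ # 1 , Z ⟩
codeᵖ π₁        = ⟨ # 2 , Z ⟩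
codeᵖ π₂        = ⟨ # 3 , Z ⟩
codeᵖ ask       = ⟨ # 4 , Z ⟩
codeᵖ I         = ⟨ # 9 , Z ⟩
codeᵖ (p ∙ q)   = ⟨ # 5 , ⟨ codeᵖ p , codeᵖ q ⟩ ⟩
codeᵖ ⟨ p , q ⟩ = ⟨ # 6 , ⟨ codeᵖ p , codeᵖ q ⟩ ⟩
codeᵖ (R p q)   = ⟨ # 7 , ⟨ codeᵖ p , codeᵖ q ⟩ ⟩

codeᵖ-correct : ∀ O p v → encode (⟦ codeᵖ p ⟧ O v) ≡ code p
codeᵖ-correct O Z v   = sym (code≡compile Z)
codeᵖ-correct O S v   = sym (code≡compile S)
codeᵖ-correct O π₁ v  = sym (code≡compile π₁)
codeᵖ-correct O π₂ v  = sym (code≡compile π₂)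
codeᵖ-correct O ask v = sym (code≡compile ask)
codeᵖ-correct O I v   = sym (code≡compile I)
codeᵖ-correct O (p ∙ q) v   = trans (cong₂ compose (codeᵖ-correct O p v) (codeᵖ-correct O q v)) (sym (code-∙ p q))
codeᵖ-correct O ⟨ p , q ⟩ v = trans (cong₂ pairing (codeᵖ-correct O p v) (codeᵖ-correct O q v)) (sym (code-⟨,⟩ p q))
codeᵖ-correct O (R p q) v   = trans (cong₂ primrec (codeᵖ-correct O p v) (codeᵖ-correct O q v)) (sym (code-R p q))

-- A small-step machine for eval

data Frame : Set where
  compose-k : (fuel a : ℕ) → Frame
  pair₁-k   : (fuel b x : ℕ) → Frame
  pair₂-k   : (u : ℕ) → Frame
  rec-k     : (fuel b x i remaining : ℕ) → Frame
  mu-k      : (fuel a x i bound : ℕ) → Frame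

data Config : Set where
  call : (fuel e x : ℕ) → List Frame → Config
  ret  : Maybe ℕ → List Frame → Config

ret-injective : ∀ {r r′ σ σ′} → ret r σ ≡ ret r′ σ′ → r ≡ r′
ret-injective refl = refl

module Machine (O : Oracle) where

  dispatch : (t fuel a b x : ℕ) → List Frame → Config
  dispatch 0 k a b x σ = ret (just zero) σ
  dispatch 1 k a b x σ = ret (just (suc x)) σ
  dispatch 2 k a b x σ = ret (just (proj₁ (unpair x))) σ
  dispatch 3 k a b x σ = ret (just (proj₂ (unpair x))) σ
  dispatch 4 k a b x σ = ret (just (O x)) σ
  dispatch 5 k a b x σ = call k b x (compose-k k a ∷ σ)
  dispatch 6 k a b x σ = call k a x (pair₁-k k b x ∷ σ)
  dispatch 7 k a b x σ = call k a (proj₁ (unpair x)) (rec-k k b (proj₁ (unpair x)) 0 (proj₂ (unpair x)) ∷ σ)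
  dispatch 8 zero a b x σ = ret nothing σ
  dispatch 8 (suc bd) a b x σ = call (suc bd) a (pair x 0) (mu-k (suc bd) a x 0 bd ∷ σ)
  dispatch (suc (suc (suc (suc (suc (suc (suc (suc (suc _))))))))) k a b x σ = ret (just x) σ

  transition : Config → Config
  transition (call zero e x σ) = ret nothing σ
  transition (call (suc k) e x σ) =
    dispatch (proj₁ (unpair e)) k (proj₁ (unpair (proj₂ (unpair e)))) (proj₂ (unpair (proj₂ (unpair e)))) x σ
  transition (ret r [])                                   = ret r []
  transition (ret nothing (_ ∷ σ))                        = ret nothing σ
  transition (ret (just r) (compose-k k a ∷ σ))           = call k a r σ
  transition (ret (just u) (pair₁-k k b x ∷ σ))           = call k b x (pair₂-k u ∷ σ)
  transition (ret (just v) (pair₂-k u ∷ σ))               = ret (just (pair u v)) σ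
  transition (ret (just r) (rec-k k b x i zero ∷ σ))      = ret (just r) σ
  transition (ret (just r) (rec-k k b x i (suc d) ∷ σ))   = call k b (pair x (pair i r)) (rec-k k b x (suc i) d ∷ σ)
  transition (ret (just zero) (mu-k k a x i bd ∷ σ))      = ret (just i) σ
  transition (ret (just (suc _)) (mu-k k a x i zero ∷ σ)) = ret nothing σ
  transition (ret (just (suc _)) (mu-k k a x i (suc bd) ∷ σ)) = call k a (pair x (suc i)) (mu-k k a x (suc i) bd ∷ σ)

  iterate : ℕ → Config → Config
  iterate zero c    = c
  iterate (suc m) c = iterate m (transition c)

  iterate-+ : ∀ m n c → iterate (m + n) c ≡ iterate n (iterate m c)
  iterate-+ zero n c    = refl
  iterate-+ (suc m) n c = iterate-+ m n (transition c)

  iterate-suc : ∀ m c → iterate (suc m) c ≡ transition (iterate m c)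
  iterate-suc zero c    = refl
  iterate-suc (suc m) c = iterate-suc m (transition c)

  iterate-final : ∀ m r → iterate m (ret r []) ≡ ret r []
  iterate-final zero r    = refl
  iterate-final (suc m) r = iterate-final m r

  _↠_ : Config → Config → Set
  c ↠ d = ∃ λ m → iterate m c ≡ d

  ↠-refl : ∀ {c} → c ↠ c
  ↠-refl = 0 , refl

  ↠-trans : ∀ {c d e} → c ↠ d → d ↠ e → c ↠ e
  ↠-trans {c} (m , refl) (n , refl) = m + n , iterate-+ m n c

  ↠-transition : ∀ {c d} → transition c ↠ d → c ↠ d
  ↠-transition (m , eq) = suc m , eq

  ret-bind : ∀ (r : Maybe ℕ) φ σ (g : ℕ → Maybe ℕ) →
             (∀ s → ret (just s) (φ ∷ σ) ↠ ret (g s) σ) → ret r (φ ∷ σ) ↠ ret (r >>= g) σ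
  ret-bind nothing  φ σ g h = ↠-transition ↠-refl
  ret-bind (just s) φ σ g h = h s

  recFrom : (k b x r i d : ℕ) → Maybe ℕ
  recFrom k b x r i zero    = just r
  recFrom k b x r i (suc d) = eval k O b (pair x (pair i r)) >>= λ r′ → recFrom k b x r′ (suc i) d

  >>=-assoc : ∀ (m : Maybe ℕ) (f g : ℕ → Maybe ℕ) → ((m >>= f) >>= g) ≡ (m >>= λ r → f r >>= g)
  >>=-assoc nothing  f g = refl
  >>=-assoc (just r) f g = refl

  recLoop-split : ∀ k a b x i d →
                  recLoop (eval k O) a b x (i + d) ≡ (recLoop (eval k O) a b x i >>= λ r → recFrom k b x r i d)
  recLoop-split k a b x i zero rewrite +-identityʳ i with recLoop (eval k O) a b x i
  ... | nothing = refl
  ... | just r  = refl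
  recLoop-split k a b x i (suc d) rewrite +-suc i d = trans (recLoop-split k a b x (suc i) d)
    (>>=-assoc (recLoop (eval k O) a b x i) (λ r → eval k O b (pair x (pair i r))) (λ r → recFrom k b x r (suc i) d))

  CallsAgree : ℕ → Set
  CallsAgree k = ∀ e x σ → call k e x σ ↠ ret (eval k O e x) σ

  module _ (k : ℕ) (agree : CallsAgree k) where

    rec-k-agrees : ∀ b x d i r σ → ret (just r) (rec-k k b x i d ∷ σ) ↠ ret (recFrom k b x r i d) σ
    rec-k-agrees b x zero i r σ    = ↠-transition ↠-refl
    rec-k-agrees b x (suc d) i r σ = ↠-transition (↠-trans (agree b (pair x (pair i r)) _)
      (ret-bind (eval k O b (pair x (pair i r))) _ σ _ (λ r′ → rec-k-agrees b x d (suc i) r′ σ)))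

    mu-k-agrees : ∀ a x bd i σ → call k a (pair x i) (mu-k k a x i bd ∷ σ) ↠ ret (muLoop (eval k O) a x i (suc bd)) σ
    mu-k-agrees a x bd i σ = ↠-trans (agree a (pair x i) _)
      (ret-bind (eval k O a (pair x i)) _ σ _ (λ where
        zero    → ↠-transition ↠-refl
        (suc n) → continue n bd))
      where
      continue : ∀ n bd → ret (just (suc n)) (mu-k k a x i bd ∷ σ) ↠ ret (muLoop (eval k O) a x (suc i) bd) σ
      continue n zero     = ↠-transition ↠-refl
      continue n (suc bd) = ↠-transition (mu-k-agrees a x bd (suc i) σ)

  dispatch-agrees : ∀ k → CallsAgree k → ∀ t a b x σ → dispatch t k a b x σ ↠ ret (step t (eval k O) O k a b x) σ
  dispatch-agrees k agree 0 a b x σ = ↠-refl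
  dispatch-agrees k agree 1 a b x σ = ↠-refl
  dispatch-agrees k agree 2 a b x σ = ↠-refl
  dispatch-agrees k agree 3 a b x σ = ↠-refl
  dispatch-agrees k agree 4 a b x σ = ↠-refl
  dispatch-agrees k agree 5 a b x σ = ↠-trans (agree b x _)
    (ret-bind (eval k O b x) (compose-k k a) σ (eval k O a) (λ r → ↠-transition (agree a r σ)))
  dispatch-agrees k agree 6 a b x σ = ↠-trans (agree a x _)
    (ret-bind (eval k O a x) (pair₁-k k b x) σ _ (λ u → ↠-transition (↠-trans (agree b x _)
      (ret-bind (eval k O b x) (pair₂-k u) σ _ (λ v → ↠-transition ↠-refl)))))
  dispatch-agrees k agree 7 a b x σ =
    subst (λ r → call k a x₁ (rec-k k b x₁ 0 n ∷ σ) ↠ ret r σ) (sym (recLoop-split k a b x₁ 0 n))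
      (↠-trans (agree a x₁ _) (ret-bind (eval k O a x₁) (rec-k k b x₁ 0 n) σ _ (λ r → rec-k-agrees k agree b x₁ n 0 r σ)))
    where
    x₁ = proj₁ (unpair x)
    n  = proj₂ (unpair x)
  dispatch-agrees zero     agree 8 a b x σ = ↠-refl
  dispatch-agrees (suc bd) agree 8 a b x σ = mu-k-agrees (suc bd) agree a x bd 0 σ
  dispatch-agrees k agree (suc (suc (suc (suc (suc (suc (suc (suc (suc _))))))))) a b x σ = ↠-refl

  call↠eval : ∀ k → CallsAgree k
  call↠eval zero e x σ    = ↠-transition ↠-refl
  call↠eval (suc k) e x σ = ↠-transition (dispatch-agrees k (call↠eval k) (proj₁ (unpair e)) _ _ x σ)

  final-unique-≤ : ∀ {c r r′} ((m , _) : c ↠ ret r []) ((m′ , _) : c ↠ ret r′ []) → m ≤ m′ → r ≡ r′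
  final-unique-≤ {c} {r} {r′} (m , run) (m′ , run′) m≤m′ with m≤n⇒∃[o]m+o≡n m≤m′
  ... | d , refl = ret-injective (begin
    ret r []                ≡⟨ sym (iterate-final d r) ⟩
    iterate d (ret r [])    ≡⟨ cong (iterate d) (sym run) ⟩
    iterate d (iterate m c) ≡⟨ sym (iterate-+ m d c) ⟩
    iterate (m + d) c       ≡⟨ run′ ⟩
    ret r′ []               ∎)
    where open ≡-Reasoning

  final-unique : ∀ {c r r′} → c ↠ ret r [] → c ↠ ret r′ [] → r ≡ r′
  final-unique run run′ with ≤-total (proj₁ run) (proj₁ run′)
  ... | inj₁ m≤m′ = final-unique-≤ run run′ m≤m′
  ... | inj₂ m′≤m = sym (final-unique-≤ run′ run m′≤m)

  final? : Config → ℕ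
  final? (ret (just _) []) = 1
  final? _                 = 0

  -- t codes the pair (fuel, number of machine steps).
  haltsWithin : ℕ → ℕ → ℕ
  haltsWithin n t = final? (iterate (proj₂ (unpair t)) (call (proj₁ (unpair t)) n n []))

  halts⇒haltsWithin : ∀ n → O ⊢Φ n ⟨ n ⟩↓ → ∃ λ t → haltsWithin n t ≡ 1
  halts⇒haltsWithin n (y , k , Φn↓) with call↠eval k n n []
  ... | m , run≡ = pair k m , final-at
    where
    final-at : haltsWithin n (pair k m) ≡ 1
    final-at rewrite unpair-pair k m | run≡ | Φn↓ = refl

  diverges⇒¬haltsWithin : ∀ n → ¬ (O ⊢Φ n ⟨ n ⟩↓) → ∀ t → haltsWithin n t ≡ 0
  diverges⇒¬haltsWithin n Φn↑ t with iterate (proj₂ (unpair t)) (call (proj₁ (unpair t)) n n []) in run≡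
  ... | call _ _ _ _          = refl
  ... | ret nothing _         = refl
  ... | ret (just _) (_ ∷ _)  = refl
  ... | ret (just y) []       = ⊥-elim (Φn↑ (y , proj₁ (unpair t) , final-unique (call↠eval (proj₁ (unpair t)) n n []) (proj₂ (unpair t) , run≡)))

-- Simulating the machine by a program

frameTree : Frame → Tree
frameTree (compose-k k a)   = node (leaf 0) (node (leaf k) (leaf a))
frameTree (pair₁-k k b x)   = node (leaf 1) (node (leaf k) (node (leaf b) (leaf x)))
frameTree (pair₂-k u)       = node (leaf 2) (leaf u)
frameTree (rec-k k b x i d) = node (leaf 3) (node (leaf k) (node (leaf b) (node (leaf x) (node (leaf i) (leaf d)))))
frameTree (mu-k k a x i d)  = node (leaf 4) (node (leaf k) (node (leaf a) (node (leaf x) (node (leaf i) (leaf d)))))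

stackTree : List Frame → Tree
stackTree []      = node (leaf 0) (leaf 0)
stackTree (φ ∷ σ) = node (leaf 1) (node (frameTree φ) (stackTree σ))

configTree : Config → Tree
configTree (call k e x σ)   = node (leaf 0) (node (leaf k) (node (leaf e) (node (leaf x) (stackTree σ))))
configTree (ret nothing σ)  = node (leaf 1) (stackTree σ)
configTree (ret (just r) σ) = node (leaf 2) (node (leaf r) (stackTree σ))

π₂^ : ℕ → Prog
π₂^ zero    = I
π₂^ (suc i) = π₂ ∙ π₂^ i

nth : ℕ → Prog
nth i = π₁ ∙ π₂^ i

-- Inside the default branch of a switch the input is node v (leaf m); ↑ p reads p off v.
↑ : Prog → Prog
↑ p = p ∙ π₁

callᵖ : Prog → Prog → Prog → Prog → Prog
callᵖ k e x σ = ⟨ # 0 , ⟨ k , ⟨ e , ⟨ x , σ ⟩ ⟩ ⟩ ⟩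

failᵖ : Prog → Prog
failᵖ σ = ⟨ # 1 , σ ⟩

returnᵖ : Prog → Prog → Prog
returnᵖ r σ = ⟨ # 2 , ⟨ r , σ ⟩ ⟩

pushᵖ : ℕ → Prog → Prog → Prog
pushᵖ tag φ σ = ⟨ # 1 , ⟨ ⟨ # tag , φ ⟩ , σ ⟩ ⟩

module TransitionProgram (q : Prog) where

  -- Read off node v (leaf k), where v encodes call (suc k) e x σ.
  fuel′ index′ arg′ stack′ a′ b′ : Prog
  fuel′  = π₂
  index′ = ↑ (nth 2)
  arg′   = ↑ (nth 3)
  stack′ = ↑ (π₂^ 4)
  a′     = nth 1 ∙ index′
  b′     = π₂^ 2 ∙ index′

  dispatchBranches : List Prog
  dispatchBranches =
      returnᵖ Z stack′
    ∷ returnᵖ (S ∙ arg′) stack′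
    ∷ returnᵖ (π₁ ∙ arg′) stack′
    ∷ returnᵖ (π₂ ∙ arg′) stack′
    ∷ returnᵖ (q ∙ arg′) stack′
    ∷ callᵖ fuel′ b′ arg′ (pushᵖ 0 ⟨ fuel′ , a′ ⟩ stack′)
    ∷ callᵖ fuel′ a′ arg′ (pushᵖ 1 ⟨ fuel′ , ⟨ b′ , arg′ ⟩ ⟩ stack′)
    ∷ callᵖ fuel′ a′ (π₁ ∙ arg′) (pushᵖ 3 ⟨ fuel′ , ⟨ b′ , ⟨ π₁ ∙ arg′ , ⟨ Z , π₂ ∙ arg′ ⟩ ⟩ ⟩ ⟩ stack′)
    ∷ if0 fuel′ (failᵖ stack′)
          (callᵖ (↑ fuel′) (↑ a′) ⟨ ↑ arg′ , Z ⟩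
                 (pushᵖ 4 ⟨ ↑ fuel′ , ⟨ ↑ a′ , ⟨ ↑ arg′ , ⟨ Z , π₂ ⟩ ⟩ ⟩ ⟩ (↑ stack′)))
    ∷ []

  dispatchDefault : Prog
  dispatchDefault = returnᵖ (↑ arg′) (↑ stack′)

  callStepᵖ : Prog
  callStepᵖ = if0 (nth 1) (failᵖ (π₂^ 4)) (switch (π₁ ∙ index′) dispatchBranches dispatchDefault)

  failStepᵖ : Prog
  failStepᵖ = if0 (nth 1) I (failᵖ (↑ (π₂^ 3)))

  -- Read off node v (leaf 0), where v encodes ret (just r) (φ ∷ σ).
  result′ frame′ stack″ payload : Prog
  result′ = ↑ (nth 1)
  frame′  = nth 1 ∙ ↑ (π₂^ 2)
  stack″  = π₂^ 2 ∙ ↑ (π₂^ 2)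
  payload = π₂ ∙ frame′

  field′ : ℕ → Prog
  field′ i = nth i ∙ payload

  resumeCompose resumePair₁ resumePair₂ resumeRec resumeMu : Prog
  resumeCompose = callᵖ (field′ 0) (π₂ ∙ payload) result′ stack″
  resumePair₁   = callᵖ (field′ 0) (field′ 1) (π₂^ 2 ∙ payload) (pushᵖ 2 result′ stack″)
  resumePair₂   = returnᵖ ⟨ payload , result′ ⟩ stack″
  resumeRec     = if0 (π₂^ 4 ∙ payload) (returnᵖ result′ stack″)
    (callᵖ (↑ (field′ 0)) (↑ (field′ 1)) ⟨ ↑ (field′ 2) , ⟨ ↑ (field′ 3) , ↑ result′ ⟩ ⟩
           (pushᵖ 3 ⟨ ↑ (field′ 0) , ⟨ ↑ (field′ 1) , ⟨ ↑ (field′ 2) , ⟨ S ∙ ↑ (field′ 3) , π₂ ⟩ ⟩ ⟩ ⟩ (↑ stack″)))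
  resumeMu      = if0 result′ (returnᵖ (field′ 3) stack″) (if0 (π₂^ 4 ∙ ↑ payload) (failᵖ (↑ stack″))
    (callᵖ (↑ (↑ (field′ 0))) (↑ (↑ (field′ 1))) ⟨ ↑ (↑ (field′ 2)) , S ∙ ↑ (↑ (field′ 3)) ⟩
           (pushᵖ 4 ⟨ ↑ (↑ (field′ 0)) , ⟨ ↑ (↑ (field′ 1)) , ⟨ ↑ (↑ (field′ 2)) , ⟨ S ∙ ↑ (↑ (field′ 3)) , π₂ ⟩ ⟩ ⟩ ⟩
                  (↑ (↑ stack″)))))

  returnStepᵖ : Prog
  returnStepᵖ = if0 (nth 2) I
    (switch (π₁ ∙ frame′) (resumeCompose ∷ resumePair₁ ∷ resumePair₂ ∷ resumeRec ∷ resumeMu ∷ []) I)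

  transitionᵖ : Prog
  transitionᵖ = switch π₁ (callStepᵖ ∷ failStepᵖ ∷ returnStepᵖ ∷ []) I

module TransitionCorrect (O O′ : Oracle) (q : Prog) (q-correct : ∀ x → encode (⟦ q ⟧ O′ (leaf x)) ≡ O x) where
  open Machine O
  open TransitionProgram q

  dispatch-correct : ∀ t k e x σ →
    encode (⟦ cases dispatchBranches dispatchDefault ⟧ O′ (node (node (configTree (call (suc k) e x σ)) (leaf k)) (leaf t)))
    ≡ encode (configTree (dispatch t k (proj₁ (unpair (proj₂ (unpair e)))) (proj₂ (unpair (proj₂ (unpair e)))) x σ))
  dispatch-correct 0 k e x σ = refl
  dispatch-correct 1 k e x σ = refl
  dispatch-correct 2 k e x σ = refl
  dispatch-correct 3 k e x σ = refl
  dispatch-correct 4 k e x σ = cong (λ m → pair 2 (pair m (encode (stackTree σ)))) (q-correct x)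
  dispatch-correct 5 k e x σ = refl
  dispatch-correct 6 k e x σ = refl
  dispatch-correct 7 k e x σ = refl
  dispatch-correct 8 zero e x σ    = refl
  dispatch-correct 8 (suc k) e x σ = refl
  dispatch-correct (suc (suc (suc (suc (suc (suc (suc (suc (suc t))))))))) k e x σ = refl

  transitionᵖ-correct : ∀ c → encode (⟦ transitionᵖ ⟧ O′ (configTree c)) ≡ encode (configTree (transition c))
  transitionᵖ-correct (call zero e x σ)                             = refl
  transitionᵖ-correct (call (suc k) e x σ)                          = dispatch-correct (proj₁ (unpair e)) k e x σ
  transitionᵖ-correct (ret nothing [])                              = refl
  transitionᵖ-correct (ret (just r) [])                             = refl
  transitionᵖ-correct (ret nothing (φ ∷ σ))                         = refl
  transitionᵖ-correct (ret (just r) (compose-k k a ∷ σ))            = refl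
  transitionᵖ-correct (ret (just r) (pair₁-k k b x ∷ σ))            = refl
  transitionᵖ-correct (ret (just r) (pair₂-k u ∷ σ))                = refl
  transitionᵖ-correct (ret (just r) (rec-k k b x i zero ∷ σ))       = refl
  transitionᵖ-correct (ret (just r) (rec-k k b x i (suc d) ∷ σ))    = refl
  transitionᵖ-correct (ret (just zero) (mu-k k a x i bd ∷ σ))       = refl
  transitionᵖ-correct (ret (just (suc r)) (mu-k k a x i zero ∷ σ))  = refl
  transitionᵖ-correct (ret (just (suc r)) (mu-k k a x i (suc bd) ∷ σ)) = refl

final?ᵖ : Prog
final?ᵖ = switch π₁ (Z ∷ Z ∷ if0 (nth 2) (# 1) Z ∷ []) Z

initᵖ : Prog → Prog
initᵖ nᵖ = callᵖ π₁ nᵖ nᵖ ⟨ Z , Z ⟩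

haltsWithinᵖ : Prog → Prog → Prog
haltsWithinᵖ q nᵖ = final?ᵖ ∙ R (initᵖ nᵖ) (TransitionProgram.transitionᵖ q ∙ π₂ ∙ π₂) ∙ ⟨ I , π₂ ⟩

module HaltsWithinCorrect (O O′ : Oracle) (q : Prog) (q-correct : ∀ x → encode (⟦ q ⟧ O′ (leaf x)) ≡ O x)
                          (n : ℕ) (nᵖ : Prog) (nᵖ-correct : ∀ t → encode (⟦ nᵖ ⟧ O′ (leaf t)) ≡ n) where
  open Machine O
  open TransitionProgram q
  open TransitionCorrect O O′ q q-correct

  final?ᵖ-correct : ∀ c → encode (⟦ final?ᵖ ⟧ O′ (configTree c)) ≡ final? c
  final?ᵖ-correct (call k e x σ)         = refl
  final?ᵖ-correct (ret nothing σ)        = refl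
  final?ᵖ-correct (ret (just r) [])      = refl
  final?ᵖ-correct (ret (just r) (_ ∷ σ)) = refl

  run : ℕ → ℕ → Tree
  run t = ⟦R initᵖ nᵖ , transitionᵖ ∙ π₂ ∙ π₂ ⟧ O′ (leaf t)

  machine : ℕ → ℕ → Config
  machine t m = iterate m (call (proj₁ (unpair t)) n n [])

  run-correct : ∀ t m → encode (run t m) ≡ encode (configTree (machine t m))
  run-correct t zero    = cong₂ (λ e x → pair 0 (pair (proj₁ (unpair t)) (pair e (pair x 0)))) (nᵖ-correct t) (nᵖ-correct t)
  run-correct t (suc m) = begin
    encode (⟦ transitionᵖ ⟧ O′ (run t m))              ≡⟨ ⟦⟧-cong O′ transitionᵖ {run t m} {configTree (machine t m)} (run-correct t m) ⟩
    encode (⟦ transitionᵖ ⟧ O′ (configTree (machine t m))) ≡⟨ transitionᵖ-correct (machine t m) ⟩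
    encode (configTree (transition (machine t m)))     ≡⟨ cong (encode ∘ configTree) (sym (iterate-suc m _)) ⟩
    encode (configTree (machine t (suc m)))            ∎
    where open ≡-Reasoning

  haltsWithinᵖ-correct : ∀ t → encode (⟦ haltsWithinᵖ q nᵖ ⟧ O′ (leaf t)) ≡ haltsWithin n t
  haltsWithinᵖ-correct t = trans (⟦⟧-cong O′ final?ᵖ {run t m} {configTree (machine t m)} (run-correct t m))
                                 (final?ᵖ-correct (machine t m))
    where m = proj₂ (unpair t)

⊢code : ∀ O p {x y} → encode (⟦ p ⟧ O (leaf x)) ≡ y → O ⊢Φ code p ⟨ x ⟩↓ y
⊢code O p {x} p≡y = subst (O ⊢Φ code p ⟨ x ⟩↓_) p≡y (code-correct O p (leaf x))

iteration : ℕ → ℕ → ℕ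
iteration a₀ s = compose (primrec (code (# a₀)) (compose s (code (π₂ ∙ π₂)))) (code ⟨ Z , I ⟩)

⊢iteration : ∀ {O} (a : ℕ → ℕ) s → (∀ i → O ⊢Φ s ⟨ a i ⟩↓ a (suc i)) → ∀ n → O ⊢Φ iteration (a 0) s ⟨ n ⟩↓ a n
⊢iteration {O} a s s↓ n = ⊢compose (⊢code O ⟨ Z , I ⟩ refl)
  (subst (λ m → O ⊢Φ primrec (code (# (a 0))) (compose s (code (π₂ ∙ π₂))) ⟨ pair 0 n ⟩↓ a m)
         (cong proj₂ (unpair-pair 0 n))
         (⊢primrec (pair 0 n) a (⊢code O (# (a 0)) (#-correct O (a 0) _)) next))
  where
  z = proj₁ (unpair (pair 0 n))
  next : ∀ i → O ⊢Φ compose s (code (π₂ ∙ π₂)) ⟨ pair z (pair i (a i)) ⟩↓ a (suc i)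
  next i = ⊢compose (code-correct O (π₂ ∙ π₂) (node (leaf z) (node (leaf i) (leaf (a i))))) (s↓ i)

module Reduction (X Y : Subset) (emb : Embedding X Y) where
  open Embedding emb
  open Machine (χ X)

  element : (p : Prog) (g : ℕ → ℕ) → (∀ n → encode (⟦ p ⟧ (χ X) (leaf n)) ≡ g n) → K₂ X
  element p g p≡g = g , code p , λ n → ⊢code (χ X) p (p≡g n)

  const : ℕ → K₂ X
  const n = element (# n) (λ _ → n) (λ t → #-correct (χ X) n (leaf t))

  halts : ℕ → K₂ X
  halts n = element (haltsWithinᵖ ask (# n)) (haltsWithin n)
    (HaltsWithinCorrect.haltsWithinᵖ-correct (χ X) (χ X) ask (λ _ → refl) n (# n) (λ t → #-correct (χ X) n (leaf t)))

  -- g · h runs the program g 0 under the oracle g ⊕ h, so an applicative element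
  -- stores its program at 0 and may keep data d at the other arguments.
  programWith : Prog → (ℕ → ℕ) → ℕ → ℕ
  programWith p d zero    = code p
  programWith p d (suc m) = d m

  applicative : (p dᵖ : Prog) (d : ℕ → ℕ) → (∀ m → encode (⟦ dᵖ ⟧ (χ X) (leaf m)) ≡ d m) → K₂ X
  applicative p dᵖ d dᵖ≡d = element (if0 I (codeᵖ p) (dᵖ ∙ π₂)) (programWith p d) λ where
    zero    → codeᵖ-correct (χ X) p (leaf zero)
    (suc m) → dᵖ≡d m

  succᵖ : Prog
  succᵖ = S ∙ ask ∙ # 1

  succ : K₂ X
  succ = applicative succᵖ Z (λ _ → 0) (λ _ → refl)

  succ·const : ∀ n → App₂ succ (const n) (const (suc n))
  succ·const n t = ⊢code (proj₁ succ ⊕ proj₁ (const n)) succᵖ refl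

  haltingᵖ : Prog
  haltingᵖ = haltsWithinᵖ (ask ∙ twice-sucᵖ) (ask ∙ # 1)

  halting : K₂ X
  halting = applicative haltingᵖ ask (χ X) (λ _ → refl)

  halting·const : ∀ n → App₂ halting (const n) (halts n)
  halting·const n t = ⊢code O′ haltingᵖ
    (HaltsWithinCorrect.haltsWithinᵖ-correct (χ X) O′ (ask ∙ twice-sucᵖ) query-X n (ask ∙ # 1) (λ _ → refl) t)
    where
    O′ = proj₁ halting ⊕ proj₁ (const n)
    query-X : ∀ x → encode (⟦ ask ∙ twice-sucᵖ ⟧ O′ (leaf x)) ≡ χ X x
    query-X x = trans (cong O′ (twice-sucᵖ-correct O′ x)) (⊕-twice (proj₁ halting) (proj₁ (const n)) (suc x))

  f-halts-index : ℕ
  f-halts-index = compose (f halting) (iteration (f (const 0)) (f succ))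

  ⊢f-halts : ∀ n → χ Y ⊢Φ f-halts-index ⟨ n ⟩↓ f (halts n)
  ⊢f-halts n = ⊢compose (⊢iteration (f ∘ const) (f succ) (λ i → f-app succ (const i) (const (suc i)) (succ·const i)) n)
                        (f-app halting (const n) (halts n) (halting·const n))

  ¬jump⇒f-halts≡ : ∀ n → ¬ Jump X n → f (halts n) ≡ f (const 0)
  ¬jump⇒f-halts≡ n ¬jump = f-wd (halts n) (const 0) (diverges⇒¬haltsWithin n ¬jump)

  jump⇒f-halts≢ : ∀ n → Jump X n → ¬ f (halts n) ≡ f (const 0)
  jump⇒f-halts≢ n jump f≡ = 1+n≢0 (trans (sym halted) (f-inj (halts n) (const 0) f≡ t))
    where
    t = proj₁ (halts⇒haltsWithin n jump)
    halted = proj₂ (halts⇒haltsWithin n jump)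

theorem6p9 : (X Y : Subset) → Embedding X Y → Jump X ≤T Y
theorem6p9 X Y emb = compose (code (≠ᵖ c₀)) f-halts-index , λ n →
    (λ jump  → decide n (≠ᵖ-≢ (χ Y) c₀ (f (halts n)) (jump⇒f-halts≢ n jump)))
  , (λ ¬jump → decide n (≠ᵖ-≡ (χ Y) c₀ (f (halts n)) (¬jump⇒f-halts≡ n ¬jump)))
  where
  open Embedding emb
  open Reduction X Y emb
  c₀ = f (const 0)
  decide : ∀ n {b} → encode (⟦ ≠ᵖ c₀ ⟧ (χ Y) (leaf (f (halts n)))) ≡ b →
           χ Y ⊢Φ compose (code (≠ᵖ c₀)) f-halts-index ⟨ n ⟩↓ b
  decide n ≠ᵖ≡b = ⊢compose (⊢f-halts n) (⊢code (χ Y) (≠ᵖ c₀) ≠ᵖ≡b)
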